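{- Let $v, w \in S_n$ be fully commutative permutations with $w = v s_i$ and $\ell(w) = \ell(v)+1$, and suppose $i \in \operatorname{supp}(v)$. Let $M := \max\{v(j) : j \le i\}$ and $m := \min\{v(j) : j \ge i+1\}$. Then the subsequence $M\, v(i)\, v(i+1)\, m$ of $v$ is an occurrence of the pattern $3142$.
   Context: A permutation is fully commutative iff it avoids $321$. $s_i$ swaps $i,i+1$ (so $vs_i$ swaps the entries of $v$ in positions $i$ and $i+1$), and $\ell$ is Coxeter length. $\operatorname{supp}(v)$ is the set of letters appearing in reduced words of $v$; equivalently $i\in\operatorname{supp}(v)$ iff $\{v(1),\dots,v(i)\}\ne\{1,\dots,i\}$. A subsequence is an occurrence of a pattern $\sigma$ if its entries are in the same relative order as $\sigma$. -}

module Defs where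

open import Data.Nat using (ℕ; zero; suc; _<_; _≤_; _⊔_; _⊓_; _<ᵇ_)
open import Data.Nat.Properties using (_<?_; _≤?_)
open import Data.Fin using (Fin; toℕ)
open import Data.Fin.Permutation using (Permutation′; _⟨$⟩ʳ_)
open import Data.List using (List; length; filter; map; foldr; allFin; cartesianProduct)
open import Data.Product using (_×_; _,_; ∃; Σ)
open import Relation.Nullary using (¬_)
open import Relation.Nullary.Decidable using (_×-dec_)
open import Relation.Binary.PropositionalEquality using (_≡_)
open import Function.Bundles using (_⇔_)

-- Positions and values are reported 1-based: position p : Fin n is
-- the position  pos p = toℕ p + 1,  and the value there is  val v p = toℕ (v p) + 1.

pos : {n : ℕ} → Fin n → ℕ
pos p = suc (toℕ p)

val : {n : ℕ} → Permutation′ n → Fin n → ℕ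
val v p = suc (toℕ (v ⟨$⟩ʳ p))

FullyCommutative : {n : ℕ} → Permutation′ n → Set
FullyCommutative {n} v =
  ¬ (Σ (Fin n) λ a → Σ (Fin n) λ b → Σ (Fin n) λ c →
       pos a < pos b × pos b < pos c × val v c < val v b × val v b < val v a)

inversions : {n : ℕ} → Permutation′ n → List (Fin n × Fin n)
inversions {n} v =
  filter (λ { (a , b) → (pos a <? pos b) ×-dec (val v b <? val v a) })
         (cartesianProduct (allFin n) (allFin n))

ℓ : {n : ℕ} → Permutation′ n → ℕ
ℓ v = length (inversions v)

InSupp : {n : ℕ} → ℕ → Permutation′ n → Set
InSupp {n} i v =
  ¬ (∀ (x : ℕ) → ((Σ (Fin n) λ p → pos p ≤ i × val v p ≡ x)) ⇔ (1 ≤ x × x ≤ i))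

-- M = max { v(j) : j ≤ i }   (the list is nonempty whenever 1 ≤ i ≤ n)
maxPrefix : {n : ℕ} → Permutation′ n → ℕ → ℕ
maxPrefix {n} v i =
  foldr _⊔_ 0 (map (val v) (filter (λ p → pos p ≤? i) (allFin n)))

-- m = min { v(j) : j ≥ i+1 }  (values are ≤ n, so n is a neutral start
-- when the list is nonempty, i.e. i+1 ≤ n)
minSuffix : {n : ℕ} → Permutation′ n → ℕ → ℕ
minSuffix {n} v i =
  foldr _⊓_ n (map (val v) (filter (λ p → suc i ≤? pos p) (allFin n)))

{-# OPTIONS --safe #-}
module Submission where

-- Since i and i+1 are adjacent, s_i sends every inversion of w = v s_i other than (i, i+1)
-- to an inversion of v, so ℓ(w) > ℓ(v) forces v(i) < v(i+1).  If M < m, every value left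
-- of the cut is below every value right of it, so v maps {1..i} onto itself and i ∉ supp(v);
-- hence m < M.  The rest is 321-avoidance: if M stood at position i, then v(i+1) M m would
-- be a 321 in w, and if m stood at i+1, then M m v(i) would be one; with M left of i and m
-- right of i+1, v(i) > m would make M v(i) m a 321 in v, and v(i+1) < M would make
-- M v(i+1) m one.

open import Defs
open import Data.Nat using (ℕ; zero; suc; _<_; _≤_; _+_; _⊔_; _⊓_; z≤n; s≤s; s≤s⁻¹; z<s)
open import Data.Nat.Properties
open import Data.Nat.ListAction using (sum)
open import Data.Nat.ListAction.Properties using (sum-++)
open import Data.Fin using (Fin; toℕ; fromℕ<; inject≤) renaming (zero to fzero; suc to fsuc; _≟_ to _≟ᶠ_)
open import Data.Fin.Properties using (toℕ-injective; toℕ<n; toℕ-fromℕ<; toℕ-inject≤; inject≤-injective; injective⇒≤)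
open import Data.Fin.Permutation using (Permutation; Permutation′; _⟨$⟩ʳ_; _⟨$⟩ˡ_; transpose; inverseˡ; inverseʳ; flip)
open import Data.List using (List; []; _∷_; length; filter; map; foldr; allFin; cartesianProduct; tabulate; _++_)
open import Data.List.Properties using (map-++; map-∘; map-cong; map-tabulate)
open import Data.List.Membership.Propositional using (_∈_)
open import Data.List.Membership.Propositional.Properties using (∈-filter⁺; ∈-filter⁻; ∈-allFin; ∈-map⁺; ∈-map⁻; foldr-selective)
open import Data.List.Relation.Unary.Any using (here; there)
open import Data.Product using (_×_; _,_; Σ; Σ-syntax; proj₂)
open import Data.Sum using (inj₁; inj₂)
open import Relation.Nullary using (¬_; Dec; yes; no; contradiction)
open import Relation.Nullary.Decidable using (decidable-stable)
open import Relation.Unary using (Pred; Decidable)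
open import Relation.Binary.PropositionalEquality
open import Function using (_∘_; id; Injective)
open import Function.Bundles using (mk⇔)
open import Level using (0ℓ)
open import Algebra.Properties.CommutativeMonoid.Sum +-0-commutativeMonoid
  using (sum-permute; sum-cong-≗) renaming (sum to ∑)

⟨$⟩ʳ-injective : ∀ {m n} (π : Permutation m n) → Injective _≡_ _≡_ (π ⟨$⟩ʳ_)
⟨$⟩ʳ-injective π {x} {y} πx≡πy = begin
  x                     ≡⟨ inverseˡ π ⟨
  π ⟨$⟩ˡ (π ⟨$⟩ʳ x)     ≡⟨ cong (π ⟨$⟩ˡ_) πx≡πy ⟩
  π ⟨$⟩ˡ (π ⟨$⟩ʳ y)     ≡⟨ inverseˡ π ⟩
  y                     ∎
  where open ≡-Reasoning

pos-injective : ∀ {n} {x y : Fin n} → pos x ≡ pos y → x ≡ y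
pos-injective = toℕ-injective ∘ suc-injective

val-injective : ∀ {n} (v : Permutation′ n) {x y : Fin n} → val v x ≡ val v y → x ≡ y
val-injective v = ⟨$⟩ʳ-injective v ∘ toℕ-injective ∘ suc-injective

module _ {n} (p q : Fin n) where

  transpose-at-p : transpose p q ⟨$⟩ʳ p ≡ q
  transpose-at-p with p ≟ᶠ p
  ... | yes _   = refl
  ... | no p≢p = contradiction refl p≢p

  transpose-at-q : transpose p q ⟨$⟩ʳ q ≡ p
  transpose-at-q with q ≟ᶠ p
  ... | yes q≡p = q≡p
  ... | no _ with q ≟ᶠ q
  ...   | yes _   = refl
  ...   | no q≢q = contradiction refl q≢q

  transpose-elsewhere : ∀ {x} → x ≢ p → x ≢ q → transpose p q ⟨$⟩ʳ x ≡ x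
  transpose-elsewhere {x} x≢p x≢q with x ≟ᶠ p
  ... | yes x≡p = contradiction x≡p x≢p
  ... | no _ with x ≟ᶠ q
  ...   | yes x≡q = contradiction x≡q x≢q
  ...   | no _    = refl

module Adjacent {n} {p q : Fin n} (adj : toℕ q ≡ suc (toℕ p)) where

  pos-q≡1+pos-p : pos q ≡ suc (pos p)
  pos-q≡1+pos-p = cong suc adj

  p<q : pos p < pos q
  p<q = ≤-reflexive (sym pos-q≡1+pos-p)

  p≢q : p ≢ q
  p≢q refl = <-irrefl refl p<q

  above-p⇒above-q : ∀ {x} → pos p < pos x → x ≢ q → pos q < pos x
  above-p⇒above-q {x} p<x x≢q =
    ≤∧≢⇒< (subst (_≤ pos x) (sym pos-q≡1+pos-p) p<x) (x≢q ∘ sym ∘ pos-injective)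

  below-q⇒below-p : ∀ {x} → pos x < pos q → x ≢ p → pos x < pos p
  below-q⇒below-p {x} x<q x≢p =
    ≤∧≢⇒< (s≤s⁻¹ (subst (pos x <_) pos-q≡1+pos-p x<q)) (x≢p ∘ pos-injective)

  transpose-preserves-< : ∀ {a b} → pos a < pos b → ¬ (a ≡ p × b ≡ q) →
    pos (transpose p q ⟨$⟩ʳ a) < pos (transpose p q ⟨$⟩ʳ b)
  transpose-preserves-< {a} {b} = by-cases (a ≟ᶠ p) (a ≟ᶠ q) (b ≟ᶠ p) (b ≟ᶠ q)
    where
    by-cases : ∀ {a b} → Dec (a ≡ p) → Dec (a ≡ q) → Dec (b ≡ p) → Dec (b ≡ q) →
      pos a < pos b → ¬ (a ≡ p × b ≡ q) →
      pos (transpose p q ⟨$⟩ʳ a) < pos (transpose p q ⟨$⟩ʳ b)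
    by-cases (yes refl) _ _ (yes refl) a<b ¬pq = contradiction (refl , refl) ¬pq
    by-cases {b = b} (yes refl) _ _ (no b≢q) a<b _
      rewrite transpose-at-p p q | transpose-elsewhere p q {b} (λ { refl → <-irrefl refl a<b }) b≢q
      = above-p⇒above-q a<b b≢q
    by-cases {b = b} (no _) (yes refl) _ _ a<b _
      rewrite transpose-at-q p q
            | transpose-elsewhere p q {b} (λ { refl → <-asym a<b p<q }) (λ { refl → <-irrefl refl a<b })
      = <-trans p<q a<b
    by-cases (no a≢p) (no a≢q) (yes refl) _ a<b _
      rewrite transpose-elsewhere p q a≢p a≢q | transpose-at-p p q
      = <-trans a<b p<q
    by-cases (no a≢p) (no a≢q) (no _) (yes refl) a<b _
      rewrite transpose-elsewhere p q a≢p a≢q | transpose-at-q p q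
      = below-q⇒below-p a<b a≢p
    by-cases (no a≢p) (no a≢q) (no b≢p) (no b≢q) a<b _
      rewrite transpose-elsewhere p q a≢p a≢q | transpose-elsewhere p q b≢p b≢q
      = a<b

indicator : ∀ {P : Set} → Dec P → ℕ
indicator (yes _) = 1
indicator (no _)  = 0

indicator-mono : ∀ {P Q : Set} → (P → Q) → (P? : Dec P) (Q? : Dec Q) → indicator P? ≤ indicator Q?
indicator-mono _   (no _)  _        = z≤n
indicator-mono _   (yes _) (yes _)  = ≤-refl
indicator-mono P⇒Q (yes p) (no ¬q) = contradiction (P⇒Q p) ¬q

length-filter≡sum-indicator : ∀ {A : Set} {P : Pred A 0ℓ} (P? : Decidable P) (xs : List A) →
  length (filter P? xs) ≡ sum (map (indicator ∘ P?) xs)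
length-filter≡sum-indicator P? []       = refl
length-filter≡sum-indicator P? (x ∷ xs) with P? x
... | yes _ = cong suc (length-filter≡sum-indicator P? xs)
... | no _  = length-filter≡sum-indicator P? xs

sum-cartesianProduct : ∀ {A B : Set} (h : A × B → ℕ) (xs : List A) (ys : List B) →
  sum (map h (cartesianProduct xs ys)) ≡ sum (map (λ x → sum (map (λ y → h (x , y)) ys)) xs)
sum-cartesianProduct h []       ys = refl
sum-cartesianProduct h (x ∷ xs) ys = begin
  sum (map h (map (x ,_) ys ++ cartesianProduct xs ys))
    ≡⟨ cong sum (map-++ h (map (x ,_) ys) (cartesianProduct xs ys)) ⟩
  sum (map h (map (x ,_) ys) ++ map h (cartesianProduct xs ys))
    ≡⟨ sum-++ (map h (map (x ,_) ys)) _ ⟩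
  sum (map h (map (x ,_) ys)) + sum (map h (cartesianProduct xs ys))
    ≡⟨ cong₂ _+_ (cong sum (sym (map-∘ ys))) (sum-cartesianProduct h xs ys) ⟩
  sum (map (λ y → h (x , y)) ys) + sum (map (λ x → sum (map (λ y → h (x , y)) ys)) xs)
    ∎
  where open ≡-Reasoning

sum-tabulate : ∀ {n} (f : Fin n → ℕ) → sum (tabulate f) ≡ ∑ f
sum-tabulate {zero}  f = refl
sum-tabulate {suc n} f = cong (f fzero +_) (sum-tabulate (f ∘ fsuc))

sum-allFin : ∀ {n} (f : Fin n → ℕ) → sum (map f (allFin n)) ≡ ∑ f
sum-allFin f = trans (cong sum (map-tabulate id f)) (sum-tabulate f)

∑-mono-≤ : ∀ {n} {f g : Fin n → ℕ} → (∀ i → f i ≤ g i) → ∑ f ≤ ∑ g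
∑-mono-≤ {zero}  f≤g = z≤n
∑-mono-≤ {suc n} f≤g = +-mono-≤ (f≤g fzero) (∑-mono-≤ (f≤g ∘ fsuc))

countPairs : ∀ {n} {P : Pred (Fin n × Fin n) 0ℓ} → Decidable P → ℕ
countPairs {n} P? = length (filter P? (cartesianProduct (allFin n) (allFin n)))

countPairs≡∑∑ : ∀ {n} {P : Pred (Fin n × Fin n) 0ℓ} (P? : Decidable P) →
  countPairs P? ≡ ∑ λ a → ∑ λ b → indicator (P? (a , b))
countPairs≡∑∑ {n} P? = begin
  countPairs P?
    ≡⟨ length-filter≡sum-indicator P? (cartesianProduct (allFin n) (allFin n)) ⟩
  sum (map (indicator ∘ P?) (cartesianProduct (allFin n) (allFin n)))
    ≡⟨ sum-cartesianProduct (indicator ∘ P?) (allFin n) (allFin n) ⟩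
  sum (map (λ a → sum (map (λ b → indicator (P? (a , b))) (allFin n))) (allFin n))
    ≡⟨ cong sum (map-cong (λ a → sum-allFin (λ b → indicator (P? (a , b)))) (allFin n)) ⟩
  sum (map (λ a → ∑ λ b → indicator (P? (a , b))) (allFin n))
    ≡⟨ sum-allFin (λ a → ∑ λ b → indicator (P? (a , b))) ⟩
  (∑ λ a → ∑ λ b → indicator (P? (a , b)))
    ∎
  where open ≡-Reasoning

countPairs-≤-along : ∀ {n} {P Q : Pred (Fin n × Fin n) 0ℓ} (P? : Decidable P) (Q? : Decidable Q)
  (σ : Permutation′ n) → (∀ {a b} → P (a , b) → Q (σ ⟨$⟩ʳ a , σ ⟨$⟩ʳ b)) →
  countPairs P? ≤ countPairs Q?
countPairs-≤-along P? Q? σ P⇒Q = begin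
  countPairs P?
    ≡⟨ countPairs≡∑∑ P? ⟩
  (∑ λ a → ∑ λ b → indicator (P? (a , b)))
    ≤⟨ ∑-mono-≤ (λ a → ∑-mono-≤ (λ b → indicator-mono P⇒Q (P? (a , b)) (Q? (σ ⟨$⟩ʳ a , σ ⟨$⟩ʳ b)))) ⟩
  (∑ λ a → ∑ λ b → indicator (Q? (σ ⟨$⟩ʳ a , σ ⟨$⟩ʳ b)))
    ≡⟨ sum-cong-≗ (λ a → sum-permute (λ b → indicator (Q? (σ ⟨$⟩ʳ a , b))) σ) ⟨
  (∑ λ a → ∑ λ b → indicator (Q? (σ ⟨$⟩ʳ a , b)))
    ≡⟨ sum-permute (λ a → ∑ λ b → indicator (Q? (a , b))) σ ⟨
  (∑ λ a → ∑ λ b → indicator (Q? (a , b)))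
    ≡⟨ countPairs≡∑∑ Q? ⟨
  countPairs Q?
    ∎
  where open ≤-Reasoning

module AdjacentSwap {n} {p q : Fin n} (adj : toℕ q ≡ suc (toℕ p)) (v w : Permutation′ n)
  (w≡v∘t : ∀ x → w ⟨$⟩ʳ x ≡ v ⟨$⟩ʳ (transpose p q ⟨$⟩ʳ x)) where

  open Adjacent adj public

  val-w : ∀ x → val w x ≡ val v (transpose p q ⟨$⟩ʳ x)
  val-w x = cong (suc ∘ toℕ) (w≡v∘t x)

  val-w-p : val w p ≡ val v q
  val-w-p = trans (val-w p) (cong (val v) (transpose-at-p p q))

  val-w-q : val w q ≡ val v p
  val-w-q = trans (val-w q) (cong (val v) (transpose-at-q p q))

  val-w-elsewhere : ∀ {x} → x ≢ p → x ≢ q → val w x ≡ val v x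
  val-w-elsewhere {x} x≢p x≢q = trans (val-w x) (cong (val v) (transpose-elsewhere p q x≢p x≢q))

  ℓ-≤-of-descent : val v q < val v p → ℓ w ≤ ℓ v
  ℓ-≤-of-descent vq<vp = countPairs-≤-along _ _ (transpose p q) inversion↦inversion
    where
    inversion↦inversion : ∀ {a b} → pos a < pos b × val w b < val w a →
      pos (transpose p q ⟨$⟩ʳ a) < pos (transpose p q ⟨$⟩ʳ b)
        × val v (transpose p q ⟨$⟩ʳ b) < val v (transpose p q ⟨$⟩ʳ a)
    inversion↦inversion {a} {b} (a<b , wb<wa) =
      transpose-preserves-< a<b not-p-q , subst₂ _<_ (val-w b) (val-w a) wb<wa
      where
      not-p-q : ¬ (a ≡ p × b ≡ q)
      not-p-q (refl , refl) = <-asym vq<vp (subst₂ _<_ val-w-q val-w-p wb<wa)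

  ascent-of-ℓ-increase : ℓ w ≡ ℓ v + 1 → val v p < val v q
  ascent-of-ℓ-increase ℓw≡ℓv+1 = decidable-stable (val v p <? val v q) λ vp≮vq →
    ≤⇒≯ (ℓ-≤-of-descent (≤∧≢⇒< (≮⇒≥ vp≮vq) (p≢q ∘ sym ∘ val-injective v)))
        (subst (ℓ v <_) (sym ℓw≡ℓv+1) (m<m+n (ℓ v) z<s))

∈⇒≤-foldr-⊔ : ∀ {x xs} → x ∈ xs → x ≤ foldr _⊔_ 0 xs
∈⇒≤-foldr-⊔ {xs = x ∷ xs} (here refl) = m≤m⊔n x _
∈⇒≤-foldr-⊔ {xs = y ∷ xs} (there x∈)  = m≤n⇒m≤o⊔n y (∈⇒≤-foldr-⊔ x∈)

∈⇒foldr-⊓-≤ : ∀ {x xs} e → x ∈ xs → foldr _⊓_ e xs ≤ x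
∈⇒foldr-⊓-≤ {xs = x ∷ xs} e (here refl) = m⊓n≤m x _
∈⇒foldr-⊓-≤ {xs = y ∷ xs} e (there x∈)  = m≤n⇒o⊓m≤n y (∈⇒foldr-⊓-≤ e x∈)

foldr-⊔-∈ : ∀ {x xs} → x ∈ xs → foldr _⊔_ 0 xs ∈ xs
foldr-⊔-∈ {x} {xs} x∈ with foldr-selective ⊔-sel 0 xs
... | inj₂ max∈ = max∈
... | inj₁ max≡0 = subst (_∈ xs) (≤-antisym (∈⇒≤-foldr-⊔ x∈) (subst (_≤ x) (sym max≡0) z≤n)) x∈

foldr-⊓-∈ : ∀ {x xs} e → x ∈ xs → x ≤ e → foldr _⊓_ e xs ∈ xs
foldr-⊓-∈ {x} {xs} e x∈ x≤e with foldr-selective ⊓-sel e xs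
... | inj₂ min∈ = min∈
... | inj₁ min≡e = subst (_∈ xs) (≤-antisym (subst (x ≤_) (sym min≡e) x≤e) (∈⇒foldr-⊓-≤ e x∈)) x∈

module _ {n} (v : Permutation′ n) {i : ℕ} where

  private
    prefix suffix : List (Fin n)
    prefix = filter (λ r → pos r ≤? i) (allFin n)
    suffix = filter (λ r → suc i ≤? pos r) (allFin n)

    ∈-prefix : ∀ {r} → pos r ≤ i → val v r ∈ map (val v) prefix
    ∈-prefix r≤i = ∈-map⁺ (val v) (∈-filter⁺ (λ r → pos r ≤? i) (∈-allFin _) r≤i)

    ∈-suffix : ∀ {r} → i < pos r → val v r ∈ map (val v) suffix
    ∈-suffix i<r = ∈-map⁺ (val v) (∈-filter⁺ (λ r → suc i ≤? pos r) (∈-allFin _) i<r)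

  maxPrefix-argmax : ∀ {p} → pos p ≤ i →
    Σ[ a ∈ Fin n ] pos a ≤ i × val v a ≡ maxPrefix v i × (∀ r → pos r ≤ i → val v r ≤ val v a)
  maxPrefix-argmax p≤i with ∈-map⁻ (val v) (foldr-⊔-∈ (∈-prefix p≤i))
  ... | a , a∈ , max≡va =
    a , proj₂ (∈-filter⁻ (λ r → pos r ≤? i) {xs = allFin n} a∈) , sym max≡va ,
    λ r r≤i → subst (val v r ≤_) max≡va (∈⇒≤-foldr-⊔ (∈-prefix r≤i))

  minSuffix-argmin : ∀ {q} → i < pos q →
    Σ[ b ∈ Fin n ] i < pos b × val v b ≡ minSuffix v i × (∀ r → i < pos r → val v b ≤ val v r)
  minSuffix-argmin {q} i<q with ∈-map⁻ (val v) (foldr-⊓-∈ n (∈-suffix i<q) (toℕ<n (v ⟨$⟩ʳ q)))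
  ... | b , b∈ , min≡vb =
    b , proj₂ (∈-filter⁻ (λ r → suc i ≤? pos r) {xs = allFin n} b∈) , sym min≡vb ,
    λ r i<r → subst (_≤ val v r) min≡vb (∈⇒foldr-⊓-≤ n (∈-suffix i<r))

injective⇒initial-segment-≤ : ∀ {m n h c} (f : Fin m → Fin n) → Injective _≡_ _≡_ f → h ≤ m →
  (∀ r → toℕ r < h → toℕ (f r) < c) → h ≤ c
injective⇒initial-segment-≤ {m} {h = h} {c = c} f f-injective h≤m f<c = injective⇒≤ g-injective
  where
  embed : Fin h → Fin m
  embed j = inject≤ j h≤m

  g : Fin h → Fin c
  g j = fromℕ< (f<c (embed j) (subst (_< h) (sym (toℕ-inject≤ j h≤m)) (toℕ<n j)))

  g-injective : Injective _≡_ _≡_ g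
  g-injective {j} {k} gj≡gk = inject≤-injective h≤m h≤m j k (f-injective (toℕ-injective (begin
    toℕ (f (embed j)) ≡⟨ toℕ-fromℕ< _ ⟨
    toℕ (g j)         ≡⟨ cong toℕ gj≡gk ⟩
    toℕ (g k)         ≡⟨ toℕ-fromℕ< _ ⟩
    toℕ (f (embed k)) ∎)))
    where open ≡-Reasoning

separated⇒¬InSupp : ∀ {n} (v : Permutation′ n) {i} → i ≤ n →
  (∀ r s → pos r ≤ i → i < pos s → val v r < val v s) → ¬ InSupp i v
separated⇒¬InSupp {n} v {i} i≤n separated i∈supp = i∈supp λ x → mk⇔ to from
  where
  to : ∀ {x} → Σ (Fin n) (λ r → pos r ≤ i × val v r ≡ x) → 1 ≤ x × x ≤ i
  to (r , r≤i , refl) =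
    s≤s z≤n , injective⇒initial-segment-≤ (v ⟨$⟩ˡ_) (⟨$⟩ʳ-injective (flip v)) (toℕ<n (v ⟨$⟩ʳ r)) in-prefix
    where
    -- every value up to val v r sits in the prefix, which has only i positions
    in-prefix : ∀ y → toℕ y < val v r → pos (v ⟨$⟩ˡ y) ≤ i
    in-prefix y y<vr = decidable-stable (pos (v ⟨$⟩ˡ y) ≤? i) λ y∉prefix →
      <⇒≱ (separated r (v ⟨$⟩ˡ y) r≤i (≰⇒> y∉prefix))
          (subst (λ z → suc (toℕ z) ≤ val v r) (sym (inverseʳ v)) y<vr)

  from : ∀ {x} → 1 ≤ x × x ≤ i → Σ (Fin n) (λ r → pos r ≤ i × val v r ≡ x)
  from {suc x} (_ , x<i) = r , r≤i , val-r
    where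
    x<n : x < n
    x<n = <-≤-trans x<i i≤n

    r : Fin n
    r = v ⟨$⟩ˡ fromℕ< x<n

    val-r : val v r ≡ suc x
    val-r = cong suc (trans (cong toℕ (inverseʳ v)) (toℕ-fromℕ< x<n))

    -- otherwise all i prefix positions would carry values below x
    r≤i : pos r ≤ i
    r≤i = decidable-stable (pos r ≤? i) λ r∉prefix →
      <⇒≱ x<i (injective⇒initial-segment-≤ (v ⟨$⟩ʳ_) (⟨$⟩ʳ-injective v) i≤n λ s s≤i →
        s≤s⁻¹ (subst (val v s <_) val-r (separated s r s≤i (≰⇒> r∉prefix))))

inSupp⇒suffix-min<prefix-max : ∀ {n} (v : Permutation′ n) {i a b} → i ≤ n → pos a ≤ i → i < pos b →
  (∀ r → pos r ≤ i → val v r ≤ val v a) → (∀ r → i < pos r → val v b ≤ val v r) →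
  InSupp i v → val v b < val v a
inSupp⇒suffix-min<prefix-max v {i} {a} {b} i≤n a≤i i<b a-max b-min i∈supp =
  decidable-stable (val v b <? val v a) λ vb≮va →
    separated⇒¬InSupp v i≤n (separated (≤∧≢⇒< (≮⇒≥ vb≮va) (a≢b ∘ val-injective v))) i∈supp
  where
  a≢b : a ≢ b
  a≢b refl = <-irrefl refl (≤-<-trans a≤i i<b)

  separated : val v a < val v b → ∀ r s → pos r ≤ i → i < pos s → val v r < val v s
  separated va<vb r s r≤i i<s = ≤-<-trans (a-max r r≤i) (<-≤-trans va<vb (b-min s i<s))

module Occurrence3142 {n} {p q : Fin n} (adj : toℕ q ≡ suc (toℕ p)) (v w : Permutation′ n)
  (w≡v∘t : ∀ x → w ⟨$⟩ʳ x ≡ v ⟨$⟩ʳ (transpose p q ⟨$⟩ʳ x))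
  (v-fc : FullyCommutative v) (w-fc : FullyCommutative w) (ascent : val v p < val v q)
  {a b : Fin n} (a≤p : pos a ≤ pos p) (p<b : pos p < pos b)
  (a-max : ∀ r → pos r ≤ pos p → val v r ≤ val v a)
  (b-min : ∀ r → pos p < pos r → val v b ≤ val v r)
  (vb<va : val v b < val v a) where

  open AdjacentSwap adj v w w≡v∘t

  w-descent : val w q < val w p
  w-descent = subst₂ _<_ (sym val-w-q) (sym val-w-p) ascent

  b≢p : b ≢ p
  b≢p refl = <-irrefl refl p<b

  a≢p : a ≢ p
  a≢p refl = w-fc (p , q , b , p<q , q<b , wb<wq , w-descent)
    where
    b≢q : b ≢ q
    b≢q refl = <-asym vb<va ascent

    q<b : pos q < pos b
    q<b = above-p⇒above-q p<b b≢q

    wb<wq : val w b < val w q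
    wb<wq = subst₂ _<_ (sym (val-w-elsewhere b≢p b≢q)) (sym val-w-q) vb<va

  a<p : pos a < pos p
  a<p = ≤∧≢⇒< a≤p (a≢p ∘ pos-injective)

  a≢q : a ≢ q
  a≢q refl = <-asym a<p p<q

  b≢q : b ≢ q
  b≢q refl = w-fc (a , p , q , a<p , p<q , w-descent , wp<wa)
    where
    wp<wa : val w p < val w a
    wp<wa = subst₂ _<_ (sym val-w-p) (sym (val-w-elsewhere a≢p a≢q)) vb<va

  q<b : pos q < pos b
  q<b = above-p⇒above-q p<b b≢q

  vp<vb : val v p < val v b
  vp<vb = decidable-stable (val v p <? val v b) λ vp≮vb →
    v-fc (a , p , b , a<p , p<b ,
          ≤∧≢⇒< (≮⇒≥ vp≮vb) (b≢p ∘ val-injective v) ,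
          ≤∧≢⇒< (a-max p ≤-refl) (a≢p ∘ sym ∘ val-injective v))

  va<vq : val v a < val v q
  va<vq = decidable-stable (val v a <? val v q) λ va≮vq →
    v-fc (a , q , b , <-trans a<p p<q , q<b ,
          ≤∧≢⇒< (b-min q p<q) (b≢q ∘ val-injective v) ,
          ≤∧≢⇒< (≮⇒≥ va≮vq) (a≢q ∘ sym ∘ val-injective v))

lemma4p1 : (n : ℕ) (v w : Permutation′ n) (p q : Fin n)
    → toℕ q ≡ suc (toℕ p)
    → FullyCommutative v
    → FullyCommutative w
    → (∀ x → w ⟨$⟩ʳ x ≡ v ⟨$⟩ʳ (transpose p q ⟨$⟩ʳ x))
    → ℓ w ≡ ℓ v + 1
    → InSupp (pos p) v
    → Σ (Fin n) λ a → Σ (Fin n) λ b →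
        pos a < pos p × pos q < pos b
        × val v a ≡ maxPrefix v (pos p)
        × val v b ≡ minSuffix v (pos p)
        × val v p < val v b × val v b < val v a × val v a < val v q
lemma4p1 n v w p q adj v-fc w-fc w≡v∘t ℓw≡ℓv+1 p∈supp =
  let a , a≤p , va≡M , a-max = maxPrefix-argmax v ≤-refl
      b , p<b , vb≡m , b-min = minSuffix-argmin v p<q
      vb<va = inSupp⇒suffix-min<prefix-max v (toℕ<n p) a≤p p<b a-max b-min p∈supp
      open Occurrence3142 adj v w w≡v∘t v-fc w-fc (ascent-of-ℓ-increase ℓw≡ℓv+1) a≤p p<b a-max b-min vb<va
  in a , b , a<p , q<b , va≡M , vb≡m , vp<vb , vb<va , va<vq
  where open AdjacentSwap adj v w w≡v∘t using (p<q; ascent-of-ℓ-increase)
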